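{- Every upwards and downwards closed monoidal frame is a BI frame.
   Context: A monoidal frame is $(X,\preccurlyeq,\circ,E)$ with $\preccurlyeq$ a preorder, $\circ:X^2\to\mathcal{P}(X)$ commutative ($z\in x\circ y\Rightarrow z\in y\circ x$) satisfying non-deterministic associativity: for all $x,y,z,t,s$, if $s\in x\circ y$ and $t\in s\circ z$ then there is $s'$ with $s'\in y\circ z$ and $t\in x\circ s'$; and $E\subseteq X$ satisfying (Unit Existence) $\exists e\in E(x\in x\circ e)$; (Coherence) $x\in y\circ e\wedge e\in E\to y\preccurlyeq x$; (Closure) $e\in E\wedge e\preccurlyeq e'\to e'\in E$. It is downwards-closed if whenever $x\in y\circ z$, $y'\preccurlyeq y$, $z'\preccurlyeq z$ there is $x'\preccurlyeq x$ with $x'\in y'\circ z'$; upwards-closed if whenever $x\in y\circ z$ and $x\preccurlyeq x'$ there exist $y'\succcurlyeq y$, $z'\succcurlyeq z$ with $x'\in y'\circ z'$. A BI frame is $(X,\preccurlyeq,\circ,E)$, $\preccurlyeq$ preorder, satisfying Commutativity, Closure ($e\in E\wedge e'\succcurlyeq e\to e'\in E$), Unit Existence, Coherence ($e\in E\wedge x\in y\circ e\to x\succcurlyeq y$), and (Associativity) $t'\succcurlyeq t\in x\circ y\wedge w\in t'\circ z\to\exists s,s',w'(s'\succcurlyeq s\in y\circ z\wedge w\succcurlyeq w'\in x\circ s')$. -}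

module Defs where

open import Level using (Level; _⊔_; suc)
open import Data.Product using (Σ; ∃; _×_; _,_)
open import Relation.Binary.Core using (Rel)
open import Relation.Binary.PropositionalEquality using (_≡_)
open import Relation.Binary.Structures using (IsPreorder)

-- The non-deterministic composition  ∘ : X² → 𝒫(X)  is represented by its
-- membership relation:  In x y z  means  x ∈ y ∘ z .
-- A subset E ⊆ X is represented by a predicate E : X → Set.

record FrameSig (a ℓ : Level) : Set (suc (a ⊔ ℓ)) where
  field
    Carrier    : Set a
    _≼_        : Rel Carrier ℓ
    isPreorder : IsPreorder _≡_ _≼_
    In         : Carrier → Carrier → Carrier → Set ℓ
    E          : Carrier → Set ℓ

module _ {a ℓ : Level} (F : FrameSig a ℓ) where
  open FrameSig F

  Commutativity : Set (a ⊔ ℓ)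
  Commutativity = ∀ x y z → In z x y → In z y x

  NDAssociativity : Set (a ⊔ ℓ)
  NDAssociativity = ∀ x y z t s → In s x y → In t s z →
    Σ Carrier λ s′ → In s′ y z × In t x s′

  UnitExistence : Set (a ⊔ ℓ)
  UnitExistence = ∀ x → Σ Carrier λ e → E e × In x x e

  Coherence : Set (a ⊔ ℓ)
  Coherence = ∀ x y e → In x y e → E e → y ≼ x

  Closure : Set (a ⊔ ℓ)
  Closure = ∀ e e′ → E e → e ≼ e′ → E e′

  record IsMonoidalFrame : Set (a ⊔ ℓ) where
    field
      comm      : Commutativity
      assoc     : NDAssociativity
      unitExist : UnitExistence
      coherence : Coherence
      closure   : Closure

  DownwardsClosed : Set (a ⊔ ℓ)
  DownwardsClosed = ∀ x y z y′ z′ → In x y z → y′ ≼ y → z′ ≼ z →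
    Σ Carrier λ x′ → x′ ≼ x × In x′ y′ z′

  UpwardsClosed : Set (a ⊔ ℓ)
  UpwardsClosed = ∀ x y z x′ → In x y z → x ≼ x′ →
    Σ Carrier λ y′ → Σ Carrier λ z′ → y ≼ y′ × z ≼ z′ × In x′ y′ z′

  BICoherence : Set (a ⊔ ℓ)
  BICoherence = ∀ e x y → E e → In x y e → y ≼ x

  BIAssociativity : Set (a ⊔ ℓ)
  BIAssociativity = ∀ x y z t t′ w → t ≼ t′ → In t x y → In w t′ z →
    Σ Carrier λ s → Σ Carrier λ s′ → Σ Carrier λ w′ →
      s ≼ s′ × In s y z × w′ ≼ w × In w′ x s′

  record IsBIFrame : Set (a ⊔ ℓ) where
    field
      comm      : Commutativity
      closure   : Closure
      unitExist : UnitExistence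
      coherence : BICoherence
      assoc     : BIAssociativity

module Submission where

open import Level using (Level)
open import Data.Product using (_,_)
open import Relation.Binary.Structures using (IsPreorder)
open import Defs

-- Only downwards closure is needed: it pulls w ∈ t′ ∘ z back to some w′ ≼ w in t ∘ z,
-- and non-deterministic associativity then rebrackets w′ with s′ = s.

module _ {a ℓ : Level} (F : FrameSig a ℓ) where
  open FrameSig F
  open IsPreorder isPreorder using (refl)

  coherence⇒biCoherence : Coherence F → BICoherence F
  coherence⇒biCoherence coh e x y Ee x∈y∘e = coh x y e x∈y∘e Ee

  ndAssociativity⇒biAssociativity :
    NDAssociativity F → DownwardsClosed F → BIAssociativity F
  ndAssociativity⇒biAssociativity assoc down x y z t t′ w t≼t′ t∈x∘y w∈t′∘z
    with down w t′ z t z w∈t′∘z t≼t′ refl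
  ... | w′ , w′≼w , w′∈t∘z with assoc x y z w′ t t∈x∘y w′∈t∘z
  ... | s , s∈y∘z , w′∈x∘s = s , s , w′ , refl , s∈y∘z , w′≼w , w′∈x∘s

  downwardsClosedMonoidalFrame⇒biFrame :
    IsMonoidalFrame F → DownwardsClosed F → IsBIFrame F
  downwardsClosedMonoidalFrame⇒biFrame M down = record
    { comm      = comm
    ; closure   = closure
    ; unitExist = unitExist
    ; coherence = coherence⇒biCoherence coherence
    ; assoc     = ndAssociativity⇒biAssociativity assoc down
    }
    where open IsMonoidalFrame M

proposition4p4 : {a ℓ : Level} (F : FrameSig a ℓ) →
    IsMonoidalFrame F → UpwardsClosed F → DownwardsClosed F → IsBIFrame F
proposition4p4 F M _ down = downwardsClosedMonoidalFrame⇒biFrame F M down
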